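{- Let $\mathbf{u}$ be a recurrent infinite word over the alphabet $\{0,1,\dots,m-1\}$, let $n\in\mathbb{N}$, and let $B\ge n$ be an integer such that the prefix $\mathbf{u}_{[B]}$ contains every factor of $\mathbf{u}$ of length $n$ and both begins and ends with $\mathbf{u}_{[n]}$. Then $$\mathcal{P}^{\mathrm{rel}}_{\mathbf{u}}(n)=\{\Psi(y)-\Psi(x)\ :\ x\text{ a prefix of }\mathbf{u}_{[B]}\mathbf{u}_{[n]}^{ -1},\ y\text{ a prefix of }\mathbf{u}_{[n]}^{ -1}\mathbf{u}_{[B]},\ |x|=|y|\}.$$
   Context: An infinite word is recurrent if each of its factors occurs infinitely often. $\mathbf{u}_{[n]}$ is the prefix of $\mathbf{u}$ of length $n$; for finite words, $x^{ -1}(xv)=v$ and $(vx)x^{ -1}=v$. $\Psi(w)=(|w|_0,\dots,|w|_{m-1})$ is the Parikh vector of a finite word $w$ ($|w|_\ell$ = number of occurrences of $\ell$). Prefixes include the empty word. The relative Parikh vector of a factor $w$ of $\mathbf{u}$ of length $n$ is $\Psi(w)-\Psi(\mathbf{u}_{[n]})$, and $\mathcal{P}^{\mathrm{rel}}_{\mathbf{u}}(n)$ is the set of relative Parikh vectors of all factors of $\mathbf{u}$ of length $n$. -}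

module Defs where

open import Data.Nat using (ℕ; zero; suc; _+_; _≤_; _∸_)
open import Data.Fin using (Fin; _≟_)
open import Data.List using (List; []; _∷_; _++_; take; drop; length)
open import Data.Vec using (Vec; tabulate; zipWith)
open import Data.Integer using (ℤ; +_; _-_)
open import Data.Product using (Σ; ∃; _×_)
open import Relation.Nullary using (yes; no)
open import Relation.Binary.PropositionalEquality using (_≡_)
open import Function.Bundles using (_⇔_)

Word : ℕ → Set
Word m = ℕ → Fin m

factorAt : ∀ {m} → Word m → ℕ → ℕ → List (Fin m)
factorAt u i zero    = []
factorAt u i (suc n) = u i ∷ factorAt u (suc i) n

pref : ∀ {m} → Word m → ℕ → List (Fin m)
pref u n = factorAt u 0 n

IsFactorOf : ∀ {m} → List (Fin m) → Word m → Set
IsFactorOf w u = ∃ λ i → w ≡ factorAt u i (length w)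

Recurrent : ∀ {m} → Word m → Set
Recurrent u = ∀ i n N → ∃ λ j → N ≤ j × factorAt u j n ≡ factorAt u i n

IsPrefix : ∀ {A : Set} → List A → List A → Set
IsPrefix x w = ∃ λ z → x ++ z ≡ w

IsSuffix : ∀ {A : Set} → List A → List A → Set
IsSuffix x w = ∃ λ z → z ++ x ≡ w

IsFinFactor : ∀ {A : Set} → List A → List A → Set
IsFinFactor x w = ∃ λ p → ∃ λ s → p ++ x ++ s ≡ w

occ : ∀ {m} → Fin m → List (Fin m) → ℕ
occ ℓ [] = 0
occ ℓ (a ∷ w) with a ≟ ℓ
... | yes _ = suc (occ ℓ w)
... | no  _ = occ ℓ w

Ψ : ∀ {m} → List (Fin m) → Vec ℕ m
Ψ w = tabulate (λ ℓ → occ ℓ w)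

ΨDiff : ∀ {m} → List (Fin m) → List (Fin m) → Vec ℤ m
ΨDiff y x = zipWith (λ a b → + a - + b) (Ψ y) (Ψ x)

Prel : ∀ {m} → Word m → ℕ → Vec ℤ m → Set
Prel u n v = Σ (List _) λ w → IsFactorOf w u × length w ≡ n × v ≡ ΨDiff w (pref u n)

-- u_[B] u_[n]^{-1}  (right quotient; meaningful when u_[B] ends with u_[n])
rquotPref : ∀ {m} → Word m → ℕ → ℕ → List (Fin m)
rquotPref u B n = take (B ∸ n) (pref u B)

-- u_[n]^{-1} u_[B]  (left quotient; meaningful when u_[B] begins with u_[n])
lquotPref : ∀ {m} → Word m → ℕ → ℕ → List (Fin m)
lquotPref u B n = drop n (pref u B)

RHSSet : ∀ {m} → Word m → ℕ → ℕ → Vec ℤ m → Set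
RHSSet u B n v = Σ (List _) λ x → Σ (List _) λ y →
  IsPrefix x (rquotPref u B n) × IsPrefix y (lquotPref u B n) ×
  length x ≡ length y × v ≡ ΨDiff y x

module Submission where

-- Write B = n + r.  The right quotient u_[B] u_[n]^{-1} is u_[r] and the left
-- quotient u_[n]^{-1} u_[B] is the factor u[n, n+r), so the right-hand set
-- consists of the vectors Ψ(u[n, n+k)) - Ψ(u_[k]) with k ≤ r.  Since every
-- length-n factor sits inside u_[n+r], the factors of length n are exactly
-- the words u[k, k+n) with k ≤ r, so P^rel(n) consists of the vectors
-- Ψ(u[k, k+n)) - Ψ(u_[n]) with k ≤ r.  The two descriptions agree term by
-- term by the exchange identity: u_[k+n] = u_[k] u[k, k+n) = u_[n] u[n, n+k)
-- gives Ψ(u[k, k+n)) - Ψ(u_[n]) = Ψ(u[n, n+k)) - Ψ(u_[k]).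
--
-- Since
-- the quotients are taken as take/drop of u_[B], the argument uses only the
-- covering hypothesis and n ≤ B.

open import Defs
open import Data.Nat using (ℕ; _≤_; zero; suc; _+_; _∸_; z≤n; s≤s)
open import Data.Nat.Properties
  using (+-suc; +-identityʳ; +-comm; m+n∸m≡n; m+[n∸m]≡n; +-cancelˡ-≤; ≤-trans; ≤-reflexive; m≤n⇒∃[o]m+o≡n)
open import Data.Integer using (ℤ; +_; _-_)
import Data.Integer as ℤ
open import Data.Integer.Tactic.RingSolver using (solve-∀)
open import Data.Vec using (Vec; _∷_; tabulate; zipWith)
open import Data.Vec.Properties using (tabulate-cong)
open import Data.Fin using (Fin; _≟_)
open import Data.List using (List; length; []; _∷_; _++_; take; drop)
open import Data.List.Properties using (∷-injective)
open import Data.Product using (_,_; _×_; ∃; proj₂)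
open import Function.Bundles using (_⇔_; mk⇔)
import Function.Properties.Equivalence as ⇔
open import Relation.Nullary using (yes; no)
open import Relation.Binary.PropositionalEquality
open ≡-Reasoning

module _ {m : ℕ} (u : Word m) where

  factorAt-length : ∀ i N → length (factorAt u i N) ≡ N
  factorAt-length i zero    = refl
  factorAt-length i (suc N) = cong suc (factorAt-length (suc i) N)

  factorAt-++ : ∀ i a b → factorAt u i (a + b) ≡ factorAt u i a ++ factorAt u (i + a) b
  factorAt-++ i zero    b rewrite +-identityʳ i = refl
  factorAt-++ i (suc a) b rewrite +-suc i a = cong (u i ∷_) (factorAt-++ (suc i) a b)

  take-factorAt : ∀ i a b → take a (factorAt u i (a + b)) ≡ factorAt u i a
  take-factorAt i zero    b = refl
  take-factorAt i (suc a) b = cong (u i ∷_) (take-factorAt (suc i) a b)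

  drop-factorAt : ∀ i a b → drop a (factorAt u i (a + b)) ≡ factorAt u (i + a) b
  drop-factorAt i zero    b rewrite +-identityʳ i = refl
  drop-factorAt i (suc a) b rewrite +-suc i a = drop-factorAt (suc i) a b

  factorAt-prefix : ∀ i {k N} → k ≤ N → IsPrefix (factorAt u i k) (factorAt u i N)
  factorAt-prefix i {k} k≤N = factorAt u (i + k) N′ ,
    (begin
      factorAt u i k ++ factorAt u (i + k) N′ ≡⟨ factorAt-++ i k N′ ⟨
      factorAt u i (k + N′)                   ≡⟨ cong (factorAt u i) (m+[n∸m]≡n k≤N) ⟩
      factorAt u i _                          ∎)
    where N′ = _ ∸ k

  prefix-of-factor : ∀ {w s} i N → w ++ s ≡ factorAt u i N →
                     length w ≤ N × w ≡ factorAt u i (length w)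
  prefix-of-factor {[]}    i N       _ = z≤n , refl
  prefix-of-factor {a ∷ w} i zero    ()
  prefix-of-factor {a ∷ w} i (suc N) e with ∷-injective e
  ... | a≡ , rest with prefix-of-factor (suc i) N rest
  ...   | bound , w≡ = s≤s bound , cong₂ _∷_ a≡ w≡

  factor-of-factor : ∀ {w} i N → IsFinFactor w (factorAt u i N) →
                     ∃ λ k → k + length w ≤ N × w ≡ factorAt u (i + k) (length w)
  factor-of-factor {w} i N ([] , s , e) with prefix-of-factor i N e
  ... | bound , w≡ = 0 , bound , trans w≡ (cong (λ j → factorAt u j (length w)) (sym (+-identityʳ i)))
  factor-of-factor     i zero    (a ∷ p , s , ())
  factor-of-factor {w} i (suc N) (a ∷ p , s , e) with factor-of-factor (suc i) N (p , s , proj₂ (∷-injective e))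
  ... | k , bound , w≡ = suc k , s≤s bound ,
        trans w≡ (cong (λ j → factorAt u j (length w)) (sym (+-suc i k)))

occ-++ : ∀ {m} (ℓ : Fin m) a b → occ ℓ (a ++ b) ≡ occ ℓ a + occ ℓ b
occ-++ ℓ []      b = refl
occ-++ ℓ (x ∷ a) b with x ≟ ℓ
... | yes _ = cong suc (occ-++ ℓ a b)
... | no  _ = occ-++ ℓ a b

zipWith-tabulate : ∀ {A B C : Set} n (f : A → B → C) (g : Fin n → A) (h : Fin n → B) →
                   zipWith f (tabulate g) (tabulate h) ≡ tabulate (λ i → f (g i) (h i))
zipWith-tabulate zero    f g h = refl
zipWith-tabulate (suc n) f g h = cong (_ ∷_) (zipWith-tabulate n f (λ i → g (Fin.suc i)) (λ i → h (Fin.suc i)))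

ΨDiff-tabulate : ∀ {m} (y x : List (Fin m)) →
                 ΨDiff y x ≡ tabulate (λ ℓ → + occ ℓ y - + occ ℓ x)
ΨDiff-tabulate {m} y x = zipWith-tabulate m _ _ _

exchange-ℤ : ∀ (A B C D : ℤ) → A ℤ.+ B ≡ C ℤ.+ D → B - C ≡ D - A
exchange-ℤ A B C D e = begin
  B - C                   ≡⟨ shift A B C ⟩
  (A ℤ.+ B) - (A ℤ.+ C)   ≡⟨ cong (λ z → z - (A ℤ.+ C)) e ⟩
  (C ℤ.+ D) - (A ℤ.+ C)   ≡⟨ cancel A C D ⟩
  D - A                   ∎
  where
  shift : ∀ (A B C : ℤ) → B - C ≡ (A ℤ.+ B) - (A ℤ.+ C)
  shift = solve-∀
  cancel : ∀ (A C D : ℤ) → (C ℤ.+ D) - (A ℤ.+ C) ≡ D - A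
  cancel = solve-∀

ΨDiff-exchange : ∀ {m} (a b c d : List (Fin m)) → a ++ b ≡ c ++ d → ΨDiff b c ≡ ΨDiff d a
ΨDiff-exchange a b c d e = begin
  ΨDiff b c                                  ≡⟨ ΨDiff-tabulate b c ⟩
  tabulate (λ ℓ → + occ ℓ b - + occ ℓ c)     ≡⟨ tabulate-cong coordinate ⟩
  tabulate (λ ℓ → + occ ℓ d - + occ ℓ a)     ≡⟨ ΨDiff-tabulate d a ⟨
  ΨDiff d a                                  ∎
  where
  counts : ∀ ℓ → occ ℓ a + occ ℓ b ≡ occ ℓ c + occ ℓ d
  counts ℓ = trans (sym (occ-++ ℓ a b)) (trans (cong (occ ℓ) e) (occ-++ ℓ c d))
  coordinate : ∀ ℓ → + occ ℓ b - + occ ℓ c ≡ + occ ℓ d - + occ ℓ a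
  coordinate ℓ = exchange-ℤ (+ occ ℓ a) (+ occ ℓ b) (+ occ ℓ c) (+ occ ℓ d) (cong +_ (counts ℓ))

-- Reading u_[k+n] as u_[k]·u[k, k+n) and as u_[n]·u[n, n+k):
-- Ψ(u[k, k+n)) - Ψ(u_[n]) = Ψ(u[n, n+k)) - Ψ(u_[k]).
relative-shift : ∀ {m} (u : Word m) n k →
                 ΨDiff (factorAt u k n) (pref u n) ≡ ΨDiff (factorAt u n k) (pref u k)
relative-shift u n k = ΨDiff-exchange (pref u k) (factorAt u k n) (pref u n) (factorAt u n k) two-readings
  where
  two-readings : pref u k ++ factorAt u k n ≡ pref u n ++ factorAt u n k
  two-readings = begin
    pref u k ++ factorAt u k n   ≡⟨ factorAt-++ u 0 k n ⟨
    pref u (k + n)               ≡⟨ cong (pref u) (+-comm k n) ⟩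
    pref u (n + k)               ≡⟨ factorAt-++ u 0 n k ⟩
    pref u n ++ factorAt u n k   ∎

module _ {m : ℕ} (u : Word m) (n r : ℕ) where

  rquot-window : rquotPref u (n + r) n ≡ pref u r
  rquot-window = begin
    take (n + r ∸ n) (pref u (n + r)) ≡⟨ cong₂ take (m+n∸m≡n n r) (cong (pref u) (+-comm n r)) ⟩
    take r (pref u (r + n))           ≡⟨ take-factorAt u 0 r n ⟩
    pref u r                          ∎

  lquot-window : lquotPref u (n + r) n ≡ factorAt u n r
  lquot-window = drop-factorAt u 0 n r

  Prel-window : (∀ (w : List (Fin m)) → IsFactorOf w u → length w ≡ n → IsFinFactor w (pref u (n + r))) →
                ∀ v → Prel u n v ⇔ ∃ λ k → k ≤ r × v ≡ ΨDiff (factorAt u k n) (pref u n)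
  Prel-window cover v = mk⇔ to from
    where
    to : Prel u n v → ∃ λ k → k ≤ r × v ≡ ΨDiff (factorAt u k n) (pref u n)
    to (w , w-factor , refl , v≡) with factor-of-factor u 0 (n + r) (cover w w-factor refl)
    ... | k , bound , w≡ = k , +-cancelˡ-≤ n k r (≤-trans (≤-reflexive (+-comm n k)) bound) ,
                           trans v≡ (cong (λ z → ΨDiff z (pref u n)) w≡)
    from : (∃ λ k → k ≤ r × v ≡ ΨDiff (factorAt u k n) (pref u n)) → Prel u n v
    from (k , _ , v≡) = factorAt u k n , (k , cong (factorAt u k) (sym (factorAt-length u k n))) ,
                        factorAt-length u k n , v≡

  RHSSet-window : ∀ v → RHSSet u (n + r) n v ⇔ ∃ λ k → k ≤ r × v ≡ ΨDiff (factorAt u n k) (pref u k)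
  RHSSet-window v = mk⇔ to from
    where
    to : RHSSet u (n + r) n v → ∃ λ k → k ≤ r × v ≡ ΨDiff (factorAt u n k) (pref u k)
    to (x , y , (sx , ex) , (sy , ey) , |x|≡|y| , v≡)
      with prefix-of-factor u {x} {sx} 0 r (trans ex rquot-window)
         | prefix-of-factor u {y} {sy} n r (trans ey lquot-window)
    ... | bound , x≡ | _ , y≡ = length x , bound ,
          trans v≡ (cong₂ ΨDiff (trans y≡ (cong (factorAt u n) (sym |x|≡|y|))) x≡)
    from : (∃ λ k → k ≤ r × v ≡ ΨDiff (factorAt u n k) (pref u k)) → RHSSet u (n + r) n v
    from (k , k≤r , v≡) = pref u k , factorAt u n k ,
      subst (IsPrefix (pref u k)) (sym rquot-window) (factorAt-prefix u 0 k≤r) ,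
      subst (IsPrefix (factorAt u n k)) (sym lquot-window) (factorAt-prefix u n k≤r) ,
      trans (factorAt-length u 0 k) (sym (factorAt-length u n k)) , v≡

corollary3p3 : (m : ℕ) (u : Word m) → Recurrent u → (n B : ℕ) → n ≤ B →
    (∀ (w : List _) → IsFactorOf w u → length w ≡ n → IsFinFactor w (pref u B)) →
    IsPrefix (pref u n) (pref u B) → IsSuffix (pref u n) (pref u B) →
    ∀ (v : Vec ℤ m) → Prel u n v ⇔ RHSSet u B n v
corollary3p3 m u _ n B n≤B cover _ _ v with m≤n⇒∃[o]m+o≡n n≤B
... | r , refl =
  ⇔.trans (Prel-window u n r cover v)
    (⇔.trans same-window (⇔.sym (RHSSet-window u n r v)))
  where
  same-window : (∃ λ k → k ≤ r × v ≡ ΨDiff (factorAt u k n) (pref u n)) ⇔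
                (∃ λ k → k ≤ r × v ≡ ΨDiff (factorAt u n k) (pref u k))
  same-window = mk⇔ (λ (k , k≤r , v≡) → k , k≤r , trans v≡ (relative-shift u n k))
                    (λ (k , k≤r , v≡) → k , k≤r , trans v≡ (sym (relative-shift u n k)))
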